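{- Let $T$ be a perfect tree, $\rho$ a weight on $T$ and $T_0$ a finite subtree of $T$. Let $k\in\omega$ and let $D\subseteq T^k$ be dense open. Then there is a finite subtree $T_1$ of $T$ with $T_0\lhd_\rho T_1$ such that for all pairwise distinct $\sigma_0,\dots,\sigma_{k-1}\in\mathrm{term}(T_0)$ and all $\sigma_0',\dots,\sigma_{k-1}'\in\mathrm{term}(T_1)$ with $\sigma_l\subseteq\sigma_l'$ for all $l<k$, we have $(\sigma_0',\dots,\sigma_{k-1}')\in D$.
   Context: Trees are on a fixed countable set $A$; $T_s=\{t\in T:t\subseteq s\text{ or }s\subseteq t\}$. $T^k$ is ordered coordinatewise by end-extension of sequences; $D\subseteq T^k$ dense open means every element of $T^k$ has a coordinatewise extension in $D$, and $D$ is closed under coordinatewise extensions. A weight on a perfect tree $T$ is a map $\rho:T\times T\to[T]^{<\omega}$ with $\rho(s,t)\subseteq T_s\setminus T_t$. $\mathrm{term}(T_0)$ is the set of terminal nodes of a finite tree $T_0$. For finite subtrees $T_0,T_1$ of $T$, $T_0\lhd_\rho T_1$ means: $T_0\subsetneq T_1$, every $t\in T_1\setminus T_0$ extends some element of $\mathrm{term}(T_0)$, and for every $\sigma\in\mathrm{term}(T_0)$ there are $N\ge2$ and an injective sequence $\langle s_i:i<N\rangle$ in $(T_1)_\sigma$ with $s_0=\sigma$, $s_{N-1}\in\mathrm{term}(T_1)$ and $\rho(s_i,s_{i+1})\subseteq T_1$ whenever $i+1<N$. -}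

module Defs where

open import Level using (0ℓ)
open import Data.Nat using (ℕ; zero; suc)
open import Data.Fin using (Fin; zero; suc; fromℕ; inject₁)
open import Data.List using (List; []; _∷_; _++_)
open import Data.List.Membership.Propositional using (_∈_)
open import Data.Product using (Σ; ∃; ∃-syntax; _×_; _,_)
open import Data.Sum using (_⊎_)
open import Relation.Nullary using (¬_)
open import Relation.Binary.PropositionalEquality using (_≡_)
open import Function.Definitions using (Injective)

Countable : Set → Set
Countable A = Σ (A → ℕ) (λ f → Injective _≡_ _≡_ f)

-- Finite sequences from A are lists; s ⊑ t : t end-extends s (s ⊆ t as functions).
_⊑_ : {A : Set} → List A → List A → Set
s ⊑ t = ∃[ u ] (s ++ u ≡ t)

_⊏_ : {A : Set} → List A → List A → Set
s ⊏ t = (s ⊑ t) × ¬ (s ≡ t)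

Comparable : {A : Set} → List A → List A → Set
Comparable s t = (s ⊑ t) ⊎ (t ⊑ s)

SeqSet : Set → Set₁
SeqSet A = List A → Set

IsTree : {A : Set} → SeqSet A → Set
IsTree T = (∃[ t ] T t) × (∀ s t → s ⊑ t → T t → T s)

IsPerfectTree : {A : Set} → SeqSet A → Set
IsPerfectTree T = IsTree T ×
  (∀ t → T t → ∃[ u ] ∃[ v ] (T u × T v × t ⊑ u × t ⊑ v × ¬ Comparable u v))

Cone : {A : Set} → SeqSet A → List A → SeqSet A
Cone T s t = T t × Comparable t s

-- Finite sets of sequences are given by lists enumerating them.
⟦_⟧ : {A : Set} → List (List A) → SeqSet A
⟦ F ⟧ t = t ∈ F

_⊆ˢ_ : {A : Set} → SeqSet A → SeqSet A → Set
S ⊆ˢ S' = ∀ t → S t → S' t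

IsWeight : {A : Set} → SeqSet A → (List A → List A → List (List A)) → Set
IsWeight T ρ = ∀ s t → T s → T t →
  ∀ u → u ∈ ρ s t → Cone T s u × ¬ Cone T t u

IsFiniteSubtree : {A : Set} → SeqSet A → List (List A) → Set
IsFiniteSubtree T F = IsTree ⟦ F ⟧ × (⟦ F ⟧ ⊆ˢ T)

term : {A : Set} → List (List A) → SeqSet A
term F σ = σ ∈ F × (∀ t → t ∈ F → ¬ (σ ⊏ t))

◁ : {A : Set} → (List A → List A → List (List A)) →
    List (List A) → List (List A) → Set
◁ ρ T0 T1 =
  (⟦ T0 ⟧ ⊆ˢ ⟦ T1 ⟧) × (∃[ t ] (t ∈ T1 × ¬ (t ∈ T0))) ×
  (∀ t → t ∈ T1 → ¬ (t ∈ T0) → ∃[ σ ] (term T0 σ × σ ⊑ t)) ×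
  (∀ σ → term T0 σ →
     -- N = m + 2 ≥ 2, sequence s : Fin N → List A
     ∃[ m ] ∃[ s ] (Injective {A = Fin (suc (suc m))} _≡_ _≡_ s
       × (∀ i → Cone ⟦ T1 ⟧ σ (s i))
       × s zero ≡ σ
       × term T1 (s (fromℕ (suc m)))
       × (∀ (i : Fin (suc m)) → ⟦ ρ (s (inject₁ i)) (s (suc i)) ⟧ ⊆ˢ ⟦ T1 ⟧)))

_≤ᵏ_ : {A : Set} {k : ℕ} → (Fin k → List A) → (Fin k → List A) → Set
x ≤ᵏ y = ∀ l → x l ⊑ y l

InPow : {A : Set} {k : ℕ} → SeqSet A → (Fin k → List A) → Set
InPow T x = ∀ l → T (x l)

IsDenseOpen : {A : Set} → SeqSet A → (k : ℕ) → ((Fin k → List A) → Set) → Set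
IsDenseOpen T k D =
  (∀ x → D x → InPow T x) ×
  (∀ x → InPow T x → ∃[ y ] (D y × x ≤ᵏ y)) ×
  (∀ x y → D x → InPow T y → x ≤ᵏ y → D y)

{-# OPTIONS --safe #-}
module Submission where

-- For each terminal σ of T0 grow a branch σ = p₀ ⊏ p₁ ⊏ ⋯ ⊏ pₖ₊₁ in T, one node per round, and
-- keep the nodes of ρ(pⱼ, pⱼ₊₁) as side nodes; T1 is the downward closure of T0, the branch tips
-- and the side nodes. Round j first extends every tip properly (T is perfect) and then extends all
-- tips and side nodes once more so that every injective k-tuple of them lies in D (density, one
-- tuple at a time; openness preserves the tuples already handled): this is the snapshot of round j.
-- A tip lies above every snapshot; a side node created in round j comes from the already extended
-- tip, so it lies above every snapshot except the j-th. The terminal nodes of T1 are the tips and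
-- side nodes, so k of them above distinct terminals of T0 lie above a common snapshot (their k
-- creation rounds miss one of the k + 1 rounds), and openness of D finishes the proof.

open import Defs
open import Data.Nat using (ℕ; zero; suc; _≤_; _<_; _≤′_; ≤′-refl; ≤′-step; z≤n; s≤s; s≤s⁻¹)
open import Data.Fin using (Fin; zero; suc; toℕ; fromℕ; inject₁)
open import Data.List using (List; []; _∷_; _++_; length; map; filter; concatMap; cartesianProductWith; inits)
open import Data.Product using (Σ; ∃; ∃-syntax; _×_; _,_; proj₁; proj₂)
open import Relation.Binary.PropositionalEquality using (_≡_; _≢_; _≗_; refl; sym; trans; cong; subst)
open import Function.Definitions using (Injective)

open import Data.Nat.Properties as ℕₚ using (≤⇒≤′; <-≤-trans; ≤-<-trans; n≮n; m≤m+n; m<m+n; n<1+n; m<1+n⇒m<n∨m≡n)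
open import Data.Fin.Properties as Finₚ using (any?; ¬∀⟶∃¬; pigeonhole; toℕ-injective; toℕ<n; toℕ-inject₁; toℕ-fromℕ)
open import Data.List.Properties using (++-identityʳ; ++-assoc; length-++; ∷-injective; ≡-dec)
open import Data.List.Membership.Propositional using (_∈_; find; lose)
open import Data.List.Membership.Propositional.Properties
  using ( ∈-++⁺ˡ; ∈-++⁺ʳ; ∈-++⁻; ∈-map⁺; ∈-map⁻; ∈-filter⁺; ∈-filter⁻; ∈-concatMap⁺; ∈-concatMap⁻
        ; ∈-cartesianProductWith⁺; ∈-cartesianProductWith⁻)
import Data.List.Membership.DecPropositional as DecMembership
open import Data.List.Relation.Unary.Any using (here; there)
open import Data.List.Relation.Unary.All as All using (All; []; _∷_)
open import Data.List.Extrema.Nat using (argmax; argmax-all; f[xs]≤f[argmax])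
import Data.Vec.Functional as Vector
open import Data.Sum as Sum using (_⊎_; inj₁; inj₂)
open import Data.Empty using (⊥-elim)
open import Function using (id; _∘_)
open import Relation.Nullary using (¬_; Dec; yes; no)
open import Relation.Nullary.Decidable using (_×-dec_; ¬?; map′)
open import Relation.Binary.Definitions using (DecidableEquality; tri<; tri≈; tri>)

countable⇒decidableEquality : {A : Set} → Countable A → DecidableEquality A
countable⇒decidableEquality (code , code-injective) x y =
  map′ code-injective (cong code) (code x ℕₚ.≟ code y)

module _ {A : Set} where

  ⊑-refl : (s : List A) → s ⊑ s
  ⊑-refl s = [] , ++-identityʳ s

  ⊑-trans : {s t w : List A} → s ⊑ t → t ⊑ w → s ⊑ w
  ⊑-trans {s} (u , refl) (v , refl) = u ++ v , sym (++-assoc s u v)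

  ⊑-reflexive : {s t : List A} → s ≡ t → s ⊑ t
  ⊑-reflexive {s} refl = ⊑-refl s

  ∷-⊑ : (a : A) {s t : List A} → s ⊑ t → (a ∷ s) ⊑ (a ∷ t)
  ∷-⊑ a (u , p) = u , cong (a ∷_) p

  ⊑-length : {s t : List A} → s ⊑ t → length s ≤ length t
  ⊑-length {s} (u , refl) = subst (length s ≤_) (sym (length-++ s)) (m≤m+n (length s) (length u))

  ⊏-length : {s t : List A} → s ⊏ t → length s < length t
  ⊏-length {s} (([] , refl) , s≢s++[]) = ⊥-elim (s≢s++[] (sym (++-identityʳ s)))
  ⊏-length {s} ((_ ∷ u , refl) , _) =
    subst (length s <_) (sym (length-++ s)) (m<m+n (length s) (s≤s z≤n))

  ⊏-⊑-trans : {s t w : List A} → s ⊏ t → t ⊑ w → s ⊏ w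
  ⊏-⊑-trans s⊏t t⊑w = ⊑-trans (proj₁ s⊏t) t⊑w , λ { refl → n≮n _ (<-≤-trans (⊏-length s⊏t) (⊑-length t⊑w)) }

  ⊑-⊏-trans : {s t w : List A} → s ⊑ t → t ⊏ w → s ⊏ w
  ⊑-⊏-trans s⊑t t⊏w = ⊑-trans s⊑t (proj₁ t⊏w) , λ { refl → n≮n _ (≤-<-trans (⊑-length s⊑t) (⊏-length t⊏w)) }

  prefixes-comparable : {s t w : List A} → s ⊑ w → t ⊑ w → Comparable s t
  prefixes-comparable {[]} {t} _ _ = inj₁ (t , refl)
  prefixes-comparable {a ∷ s} {[]} _ _ = inj₂ (a ∷ s , refl)
  prefixes-comparable {a ∷ s} {b ∷ t} (u , refl) (v , q) with ∷-injective q
  ... | refl , q′ = Sum.map (∷-⊑ a) (∷-⊑ a) (prefixes-comparable (u , refl) (v , q′))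

  incomparable-mono : {s t s′ t′ : List A} → ¬ Comparable s t → s ⊑ s′ → t ⊑ t′ → ¬ Comparable s′ t′
  incomparable-mono s∦t s⊑s′ t⊑t′ (inj₁ s′⊑t′) = s∦t (prefixes-comparable (⊑-trans s⊑s′ s′⊑t′) t⊑t′)
  incomparable-mono s∦t s⊑s′ t⊑t′ (inj₂ t′⊑s′) = s∦t (prefixes-comparable s⊑s′ (⊑-trans t⊑t′ t′⊑s′))

  ∈-inits⁺ : {u w : List A} → u ⊑ w → u ∈ inits w
  ∈-inits⁺ {[]} _ = here refl
  ∈-inits⁺ {a ∷ u} {[]} (_ , ())
  ∈-inits⁺ {a ∷ u} {b ∷ w} (v , p) with ∷-injective p
  ... | refl , q = there (∈-map⁺ (a ∷_) (∈-inits⁺ (v , q)))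

  ∈-inits⁻ : {u w : List A} → u ∈ inits w → u ⊑ w
  ∈-inits⁻ {w = w} (here refl) = w , refl
  ∈-inits⁻ {w = a ∷ w} (there u∈) with ∈-map⁻ (a ∷_) {xs = inits w} u∈
  ... | _ , u∈inits , refl = ∷-⊑ a (∈-inits⁻ u∈inits)

  terminal-exists : {F : List (List A)} {t : List A} → t ∈ F → ∃[ σ ] term F σ
  terminal-exists {F} {t} t∈F = longest , longest∈F , λ u u∈F longest⊏u →
      n≮n _ (<-≤-trans (⊏-length longest⊏u) (All.lookup (f[xs]≤f[argmax] {f = length} t F) u∈F))
    where
    longest : List A
    longest = argmax length t F
    longest∈F : longest ∈ F
    longest∈F = argmax-all length t∈F (All.tabulate id)

  ⊑-dec : DecidableEquality A → (s t : List A) → Dec (s ⊑ t)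
  ⊑-dec _≟_ [] t = yes (t , refl)
  ⊑-dec _≟_ (a ∷ s) [] = no λ { (_ , ()) }
  ⊑-dec _≟_ (a ∷ s) (b ∷ t) with a ≟ b | ⊑-dec _≟_ s t
  ... | yes refl | yes s⊑t = yes (∷-⊑ a s⊑t)
  ... | yes refl | no s⋢t = no λ { (u , p) → s⋢t (u , proj₂ (∷-injective p)) }
  ... | no a≢b | _ = no λ { (u , p) → a≢b (proj₁ (∷-injective p)) }

  term-maximal : DecidableEquality (List A) → {F : List (List A)} {σ t : List A} →
    term F σ → t ∈ F → σ ⊑ t → σ ≡ t
  term-maximal _≟_ {σ = σ} {t} (_ , maximal) t∈F σ⊑t with σ ≟ t
  ... | yes σ≡t = σ≡t
  ... | no σ≢t = ⊥-elim (maximal t t∈F (σ⊑t , σ≢t))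

  terms-below-unique : DecidableEquality (List A) → {F : List (List A)} {σ τ x : List A} →
    term F σ → term F τ → σ ⊑ x → τ ⊑ x → σ ≡ τ
  terms-below-unique _≟_ σ-term τ-term σ⊑x τ⊑x with prefixes-comparable σ⊑x τ⊑x
  ... | inj₁ σ⊑τ = term-maximal _≟_ σ-term (proj₁ τ-term) σ⊑τ
  ... | inj₂ τ⊑σ = sym (term-maximal _≟_ τ-term (proj₁ σ-term) τ⊑σ)

  module _ {T : SeqSet A} where

    perfect-proper-extension : IsPerfectTree T → {x : List A} → T x → ∃[ u ] (x ⊏ u × T u)
    perfect-proper-extension perfect {x} x∈T with proj₂ perfect x x∈T
    ... | u , v , u∈T , _ , x⊑u , x⊑v , u∦v = u , (x⊑u , λ { refl → u∦v (inj₁ x⊑v) }) , u∈T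

    weight-branches-off : {ρ : List A → List A → List (List A)} → IsWeight T ρ →
      {s t u : List A} → T s → T t → s ⊑ t → u ∈ ρ s t → T u × s ⊑ u × ¬ Comparable u t
    weight-branches-off weight {s} {t} {u} s∈T t∈T s⊑t u∈ρ with weight s t s∈T t∈T u u∈ρ
    ... | (u∈T , u≍s) , u∉Tₜ = u∈T , s⊑u u≍s , u∦t
      where
      u∦t : ¬ Comparable u t
      u∦t u≍t = u∉Tₜ (u∈T , u≍t)
      s⊑u : Comparable u s → s ⊑ u
      s⊑u (inj₁ u⊑s) = ⊥-elim (u∦t (inj₁ (⊑-trans u⊑s s⊑t)))
      s⊑u (inj₂ s⊑u) = s⊑u

avoid-values : {n : ℕ} (b : Fin n → ℕ) → Σ (Fin (suc n)) λ r → ∀ l → toℕ r ≢ b l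
avoid-values {n} b =
  let r , r-missed = ¬∀⟶∃¬ (suc n) _ (λ r → any? (λ l → toℕ r ℕₚ.≟ b l)) all-hit
  in r , λ l r≡bl → r-missed (l , r≡bl)
  where
  all-hit : ¬ (∀ (r : Fin (suc n)) → ∃[ l ] (toℕ r ≡ b l))
  all-hit hit with pigeonhole (n<1+n n) (proj₁ ∘ hit)
  ... | i , j , i<j , same =
    Finₚ.<⇒≢ i<j (toℕ-injective (trans (proj₂ (hit i)) (trans (cong b same) (sym (proj₂ (hit j))))))

tuples : {X : Set} (n : ℕ) → List X → List (Fin n → X)
tuples zero    xs = (λ ()) ∷ []
tuples (suc n) xs = cartesianProductWith Vector._∷_ xs (tuples n xs)

tuples-sound : {X : Set} (n : ℕ) (xs : List X) {f : Fin n → X} → f ∈ tuples n xs → ∀ l → f l ∈ xs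
tuples-sound (suc n) xs f∈ l with ∈-cartesianProductWith⁻ Vector._∷_ xs (tuples n xs) f∈
tuples-sound (suc n) xs f∈ zero    | _ , _ , x∈xs , _ , refl = x∈xs
tuples-sound (suc n) xs f∈ (suc l) | _ , _ , _ , g∈ , refl = tuples-sound n xs g∈ l

tuples-complete : {X : Set} (n : ℕ) (xs : List X) (g : Fin n → X) → (∀ l → g l ∈ xs) →
  ∃[ f ] (f ∈ tuples n xs × f ≗ g)
tuples-complete zero xs g _ = (λ ()) , here refl , λ ()
tuples-complete (suc n) xs g g∈ with tuples-complete n xs (Vector.tail g) (g∈ ∘ suc)
... | f , f∈ , f≗ = g zero Vector.∷ f , ∈-cartesianProductWith⁺ Vector._∷_ (g∈ zero) f∈ , head-tail
  where
  head-tail : (g zero Vector.∷ f) ≗ g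
  head-tail zero = refl
  head-tail (suc l) = f≗ l

InjectiveTuplesIn : {A : Set} {k : ℕ} → List (List A) → ((Fin k → List A) → Set) → Set
InjectiveTuplesIn X D = ∀ y → (∀ l → y l ∈ X) → Injective _≡_ _≡_ y → D y

module DenseExtension {A : Set} (_≟_ : DecidableEquality (List A)) (T : SeqSet A) {k : ℕ}
  {D : (Fin k → List A) → Set} (dense-open : IsDenseOpen T k D) where

  D⊆Tᵏ : ∀ x → D x → InPow T x
  D⊆Tᵏ = proj₁ dense-open

  D-dense : ∀ x → InPow T x → ∃[ y ] (D y × x ≤ᵏ y)
  D-dense = proj₁ (proj₂ dense-open)

  D-open : ∀ x y → D x → InPow T y → x ≤ᵏ y → D y
  D-open = proj₂ (proj₂ dense-open)

  update : (Fin k → List A) → (Fin k → List A) → (List A → List A) → List A → List A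
  update f y e x with any? (λ l → f l ≟ x)
  ... | yes (l , _) = y l
  ... | no _ = e x

  update-⊒ : ∀ f y e → (∀ l → e (f l) ⊑ y l) → ∀ x → e x ⊑ update f y e x
  update-⊒ f y e e∘f≤y x with any? (λ l → f l ≟ x)
  ... | yes (l , refl) = e∘f≤y l
  ... | no _ = ⊑-refl (e x)

  update-∈T : ∀ f y e {L : List (List A)} → (∀ {x} → x ∈ L → T (e x)) → InPow T y →
    ∀ {x} → x ∈ L → T (update f y e x)
  update-∈T f y e e∈T y∈T {x} x∈L with any? (λ l → f l ≟ x)
  ... | yes (l , _) = y∈T l
  ... | no _ = e∈T x∈L

  update-hit : ∀ f y e → Injective _≡_ _≡_ f → ∀ l → update f y e (f l) ≡ y l
  update-hit f y e f-injective l with any? (λ l′ → f l′ ≟ f l)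
  ... | yes (l′ , fl′≡fl) = cong y (f-injective fl′≡fl)
  ... | no miss = ⊥-elim (miss (l , refl))

  meet-tasks : (L : List (List A)) (tasks : List (Fin k → List A)) → All (λ f → ∀ l → f l ∈ L) tasks →
    (e : List A → List A) → (∀ {x} → x ∈ L → T (e x)) →
    ∃[ e′ ] ((∀ x → e x ⊑ e′ x) × (∀ {x} → x ∈ L → T (e′ x)) ×
             All (λ f → Injective _≡_ _≡_ f → D (e′ ∘ f)) tasks)
  meet-tasks L [] [] e e∈T = e , ⊑-refl ∘ e , e∈T , []
  meet-tasks L (f ∷ tasks) (f∈L ∷ tasks∈L) e e∈T with meet-tasks L tasks tasks∈L e e∈T
  ... | e₁ , e≤e₁ , e₁∈T , met with D-dense (e₁ ∘ f) (e₁∈T ∘ f∈L)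
  ... | y , y∈D , e₁∘f≤y =
    e₂ , (λ x → ⊑-trans (e≤e₁ x) (e₁≤e₂ x)) , e₂∈T , f-met ∷ All.zipWith keep-met (tasks∈L , met)
    where
    e₂ : List A → List A
    e₂ = update f y e₁
    e₁≤e₂ : ∀ x → e₁ x ⊑ e₂ x
    e₁≤e₂ = update-⊒ f y e₁ e₁∘f≤y
    e₂∈T : ∀ {x} → x ∈ L → T (e₂ x)
    e₂∈T = update-∈T f y e₁ e₁∈T (D⊆Tᵏ y y∈D)
    f-met : Injective _≡_ _≡_ f → D (e₂ ∘ f)
    f-met f-injective = D-open y (e₂ ∘ f) y∈D (e₂∈T ∘ f∈L)
      (λ l → ⊑-reflexive (sym (update-hit f y e₁ f-injective l)))
    keep-met : ∀ {g} → (∀ l → g l ∈ L) × (Injective _≡_ _≡_ g → D (e₁ ∘ g)) →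
      Injective _≡_ _≡_ g → D (e₂ ∘ g)
    keep-met {g} (g∈L , g-met) g-injective =
      D-open (e₁ ∘ g) (e₂ ∘ g) (g-met g-injective) (e₂∈T ∘ g∈L) (e₁≤e₂ ∘ g)

  image-meets : (e : List A → List A) (L : List (List A)) → (∀ {x} → x ∈ L → T (e x)) →
    (∀ g → (∀ l → g l ∈ L) → Injective _≡_ _≡_ g → D (e ∘ g)) → InjectiveTuplesIn (map e L) D
  image-meets e L e∈T meets y y∈ y-injective =
    D-open (e ∘ g) y (meets g g∈L g-injective) (λ l → subst T (e∘g≡y l) (e∈T (g∈L l))) (⊑-reflexive ∘ e∘g≡y)
    where
    g : Fin k → List A
    g l = proj₁ (∈-map⁻ e (y∈ l))
    g∈L : ∀ l → g l ∈ L
    g∈L l = proj₁ (proj₂ (∈-map⁻ e (y∈ l)))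
    e∘g≡y : ∀ l → e (g l) ≡ y l
    e∘g≡y l = sym (proj₂ (proj₂ (∈-map⁻ e (y∈ l))))
    g-injective : Injective _≡_ _≡_ g
    g-injective {a} {b} ga≡gb = y-injective (trans (sym (e∘g≡y a)) (trans (cong e ga≡gb) (e∘g≡y b)))

  record Refinement (L : List (List A)) : Set where
    field
      refine : List A → List A
      refine-⊒ : ∀ x → x ⊑ refine x
      refine∈T : ∀ {x} → x ∈ L → T (refine x)
      refine-meets : InjectiveTuplesIn (map refine L) D

  dense-extension : (L : List (List A)) → (∀ {x} → x ∈ L → T x) → Refinement L
  dense-extension L L⊆T with meet-tasks L (tuples k L) (All.tabulate (tuples-sound k L)) id L⊆T
  ... | e , x⊑ex , e∈T , met = record
    { refine = e ; refine-⊒ = x⊑ex ; refine∈T = e∈T ; refine-meets = image-meets e L e∈T meets }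
    where
    meets : ∀ g → (∀ l → g l ∈ L) → Injective _≡_ _≡_ g → D (e ∘ g)
    meets g g∈L g-injective with tuples-complete k L g g∈L
    ... | f , f∈ , f≗g = D-open (e ∘ f) (e ∘ g) (All.lookup met f∈ f-injective) (e∈T ∘ g∈L)
                           (λ l → ⊑-reflexive (cong e (f≗g l)))
      where
      f-injective : Injective _≡_ _≡_ f
      f-injective {a} {b} fa≡fb = g-injective (trans (sym (f≗g a)) (trans fa≡fb (f≗g b)))

module Construction
  {A : Set} (_≟ᴬ_ : DecidableEquality A)
  (T : SeqSet A) (perfect : IsPerfectTree T)
  (ρ : List A → List A → List (List A)) (weight : IsWeight T ρ)
  (T0 : List (List A)) (T0-finite : IsFiniteSubtree T T0)
  (k : ℕ) (D : (Fin k → List A) → Set) (dense-open : IsDenseOpen T k D) where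

  _≟_ : DecidableEquality (List A)
  _≟_ = ≡-dec _≟ᴬ_

  open DenseExtension _≟_ T dense-open using (D-open; Refinement; dense-extension)
  open DecMembership _≟_ using (_∈?_)

  T0⊆T : ∀ {t} → t ∈ T0 → T t
  T0⊆T = proj₂ T0-finite _

  maximal? : ∀ σ → Dec (All (λ t → ¬ σ ⊏ t) T0)
  maximal? σ = All.all? (λ t → ¬? (⊑-dec _≟ᴬ_ σ t ×-dec ¬? (σ ≟ t))) T0

  terminals : List (List A)
  terminals = filter maximal? T0

  ∈-terminals⁻ : ∀ {σ} → σ ∈ terminals → term T0 σ
  ∈-terminals⁻ σ∈ with ∈-filter⁻ maximal? {xs = T0} σ∈
  ... | σ∈T0 , maximal = σ∈T0 , λ t t∈T0 → All.lookup maximal t∈T0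

  ∈-terminals⁺ : ∀ {σ} → term T0 σ → σ ∈ terminals
  ∈-terminals⁺ (σ∈T0 , maximal) =
    ∈-filter⁺ maximal? σ∈T0 (All.tabulate (maximal _))

  terminal-unique : ∀ {σ τ x} → σ ∈ terminals → τ ∈ terminals → σ ⊑ x → τ ⊑ x → σ ≡ τ
  terminal-unique σ∈ τ∈ = terms-below-unique _≟_ (∈-terminals⁻ σ∈) (∈-terminals⁻ τ∈)

  record Stage : Set where
    field
      tip : List A → List A
      tip∈T : ∀ {σ} → σ ∈ terminals → T (tip σ)
      sides : List (List A)
      sides⊆T : ∀ {w} → w ∈ sides → T w

  initial : Stage
  initial = record
    { tip = id ; tip∈T = T0⊆T ∘ proj₁ ∘ ∈-terminals⁻ ; sides = [] ; sides⊆T = λ () }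

  module Round (S : Stage) where
    open Stage S

    proper-extension : ∀ {σ} → σ ∈ terminals → ∃[ u ] (tip σ ⊏ u × T u)
    proper-extension σ∈ = perfect-proper-extension perfect (tip∈T σ∈)

    -- Tips are only known to lie in T at terminals; the value elsewhere is never used.
    grown : List A → List A
    grown σ with σ ∈? terminals
    ... | yes σ∈ = proj₁ (proper-extension σ∈)
    ... | no _ = tip σ

    grown-proper : ∀ {σ} → σ ∈ terminals → tip σ ⊏ grown σ × T (grown σ)
    grown-proper {σ} σ∈ with σ ∈? terminals
    ... | yes σ∈′ = proj₂ (proper-extension σ∈′)
    ... | no σ∉ = ⊥-elim (σ∉ σ∈)

    active : List (List A)
    active = map grown terminals ++ sides

    active⊆T : ∀ {x} → x ∈ active → T x
    active⊆T x∈ with ∈-++⁻ (map grown terminals) x∈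
    ... | inj₂ x∈sides = sides⊆T x∈sides
    ... | inj₁ x∈grown with ∈-map⁻ grown x∈grown
    ... | σ , σ∈ , refl = proj₂ (grown-proper σ∈)

    open Refinement (dense-extension active active⊆T) public

    snapshot : List (List A)
    snapshot = map refine active

    grown∈active : ∀ {σ} → σ ∈ terminals → grown σ ∈ active
    grown∈active σ∈ = ∈-++⁺ˡ (∈-map⁺ grown σ∈)

    side∈active : ∀ {w} → w ∈ sides → w ∈ active
    side∈active = ∈-++⁺ʳ (map grown terminals)

    tip⊏next-tip : ∀ {σ} → σ ∈ terminals → tip σ ⊏ refine (grown σ)
    tip⊏next-tip {σ} σ∈ = ⊏-⊑-trans (proj₁ (grown-proper σ∈)) (refine-⊒ (grown σ))

    new-sides : List (List A)
    new-sides = concatMap (λ σ → ρ (tip σ) (refine (grown σ))) terminals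

    next-sides : List (List A)
    next-sides = map refine sides ++ new-sides

    next-sides⊆T : ∀ {w} → w ∈ next-sides → T w
    next-sides⊆T w∈ with ∈-++⁻ (map refine sides) w∈
    ... | inj₁ w∈old with ∈-map⁻ refine w∈old
    ...   | x , x∈ , refl = refine∈T (side∈active x∈)
    next-sides⊆T w∈ | inj₂ w∈new with find (∈-concatMap⁻ _ {xs = terminals} w∈new)
    ...   | σ , σ∈ , w∈ρ = proj₁ (weight-branches-off weight (tip∈T σ∈) (refine∈T (grown∈active σ∈))
                                   (proj₁ (tip⊏next-tip σ∈)) w∈ρ)

    next : Stage
    next = record
      { tip = refine ∘ grown ; tip∈T = refine∈T ∘ grown∈active
      ; sides = next-sides ; sides⊆T = next-sides⊆T }

  stage : ℕ → Stage
  stage zero = initial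
  stage (suc j) = Round.next (stage j)

  path : List A → ℕ → List A
  path σ j = Stage.tip (stage j) σ

  snapshot : ℕ → List (List A)
  snapshot j = Round.snapshot (stage j)

  refine : ℕ → List A → List A
  refine j = Round.refine (stage j)

  sides : ℕ → List (List A)
  sides j = Stage.sides (stage j)

  path-step : ∀ {σ} j → σ ∈ terminals → path σ j ⊏ path σ (suc j)
  path-step j = Round.tip⊏next-tip (stage j)

  path-mono : ∀ {σ r j} → σ ∈ terminals → r ≤′ j → path σ r ⊑ path σ j
  path-mono {σ} {r} σ∈ ≤′-refl = ⊑-refl (path σ r)
  path-mono σ∈ (≤′-step {j} r≤j) = ⊑-trans (path-mono σ∈ r≤j) (proj₁ (path-step j σ∈))

  path-⊑ : ∀ {σ r j} → σ ∈ terminals → r ≤ j → path σ r ⊑ path σ j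
  path-⊑ σ∈ = path-mono σ∈ ∘ ≤⇒≤′

  path-⊏ : ∀ {σ r j} → σ ∈ terminals → r < j → path σ r ⊏ path σ j
  path-⊏ {r = r} σ∈ r<j = ⊏-⊑-trans (path-step r σ∈) (path-⊑ σ∈ r<j)

  terminal⊑path : ∀ {σ} j → σ ∈ terminals → σ ⊑ path σ j
  terminal⊑path j σ∈ = path-⊑ σ∈ (z≤n {j})

  path∈snapshot : ∀ {σ} j → σ ∈ terminals → path σ (suc j) ∈ snapshot j
  path∈snapshot j σ∈ = ∈-map⁺ (refine j) (Round.grown∈active (stage j) σ∈)

  AboveSnapshot : ℕ → List A → Set
  AboveSnapshot r w = ∃[ y ] (y ∈ snapshot r × y ⊑ w)

  path-above-snapshots : ∀ {σ r j} → σ ∈ terminals → r < j → AboveSnapshot r (path σ j)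
  path-above-snapshots {σ} {r} σ∈ r<j = path σ (suc r) , path∈snapshot r σ∈ , path-⊑ σ∈ r<j

  record SideNode (j : ℕ) (w : List A) : Set where
    field
      owner : List A
      owner∈terminals : owner ∈ terminals
      owner⊑ : owner ⊑ w
      off-path : ¬ Comparable w (path owner j)
      birth : ℕ
      above-snapshots : ∀ {r} → r < j → r ≢ birth → AboveSnapshot r w

  refined-side-node : ∀ {j w} → w ∈ sides j → SideNode j w → SideNode (suc j) (refine j w)
  refined-side-node {j} {w} w∈ node = record
    { owner = owner ; owner∈terminals = owner∈terminals
    ; owner⊑ = ⊑-trans owner⊑ w⊑
    ; off-path = incomparable-mono off-path w⊑ (proj₁ (path-step j owner∈terminals))
    ; birth = birth
    ; above-snapshots = above }
    where
    open SideNode node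
    w⊑ : w ⊑ refine j w
    w⊑ = Round.refine-⊒ (stage j) w
    above : ∀ {r} → r < suc j → r ≢ birth → AboveSnapshot r (refine j w)
    above r<1+j r≢birth with m<1+n⇒m<n∨m≡n r<1+j
    ... | inj₁ r<j = let y , y∈ , y⊑w = above-snapshots r<j r≢birth in y , y∈ , ⊑-trans y⊑w w⊑
    ... | inj₂ refl = refine j w , ∈-map⁺ (refine j) (Round.side∈active (stage j) w∈) , ⊑-refl _

  weight-side-node : ∀ {σ j u} → σ ∈ terminals → u ∈ ρ (path σ j) (path σ (suc j)) → SideNode (suc j) u
  weight-side-node {σ} {j} {u} σ∈ u∈ρ
    with weight-branches-off weight (Stage.tip∈T (stage j) σ∈) (Stage.tip∈T (stage (suc j)) σ∈)
                                    (proj₁ (path-step j σ∈)) u∈ρ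
  ... | _ , path⊑u , u∦path = record
    { owner = σ ; owner∈terminals = σ∈ ; owner⊑ = ⊑-trans (terminal⊑path j σ∈) path⊑u
    ; off-path = u∦path ; birth = j ; above-snapshots = above }
    where
    above : ∀ {r} → r < suc j → r ≢ j → AboveSnapshot r u
    above r<1+j r≢j with path-above-snapshots σ∈ (ℕₚ.≤∧≢⇒< (s≤s⁻¹ r<1+j) r≢j)
    ... | y , y∈ , y⊑path = y , y∈ , ⊑-trans y⊑path path⊑u

  sides-are-side-nodes : ∀ j {w} → w ∈ sides j → SideNode j w
  sides-are-side-nodes (suc j) w∈ with ∈-++⁻ (map (refine j) (sides j)) w∈
  ... | inj₁ w∈old with ∈-map⁻ (refine j) w∈old
  ...   | x , x∈ , refl = refined-side-node x∈ (sides-are-side-nodes j x∈)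
  sides-are-side-nodes (suc j) w∈ | inj₂ w∈new with find (∈-concatMap⁻ _ {xs = terminals} w∈new)
  ...   | σ , σ∈ , w∈ρ = weight-side-node σ∈ w∈ρ

  snapshot-owned : ∀ {j y} → y ∈ snapshot j → ∃[ σ ] (σ ∈ terminals × σ ⊑ y)
  snapshot-owned {j} y∈ with ∈-map⁻ (refine j) y∈
  ... | x , x∈ , refl with ∈-++⁻ (map (Round.grown (stage j)) terminals) x∈
  ...   | inj₁ x∈grown with ∈-map⁻ (Round.grown (stage j)) x∈grown
  ...     | σ , σ∈ , refl = σ , σ∈ , terminal⊑path (suc j) σ∈
  snapshot-owned {j} y∈ | x , x∈ , refl | inj₂ x∈sides =
    owner , owner∈terminals , ⊑-trans owner⊑ (Round.refine-⊒ (stage j) x)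
    where open SideNode (sides-are-side-nodes j x∈sides)

  Covered : ℕ → List A → Set
  Covered j u = ∃[ w ] (w ∈ sides j × u ⊑ w)

  covered-mono : ∀ {r j u} → r ≤′ j → Covered r u → Covered j u
  covered-mono ≤′-refl covered = covered
  covered-mono (≤′-step {j} r≤j) covered with covered-mono r≤j covered
  ... | w , w∈ , u⊑w =
    refine j w , ∈-++⁺ˡ (∈-map⁺ (refine j) w∈) , ⊑-trans u⊑w (Round.refine-⊒ (stage j) w)

  weights-covered : ∀ {σ r j u} → σ ∈ terminals → r < j → u ∈ ρ (path σ r) (path σ (suc r)) → Covered j u
  weights-covered {u = u} σ∈ r<j u∈ρ =
    covered-mono (≤⇒≤′ r<j) (u , ∈-++⁺ʳ _ (∈-concatMap⁺ _ (lose σ∈ u∈ρ)) , ⊑-refl u)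

  path-injective : ∀ {σ r r′} → σ ∈ terminals → path σ r ≡ path σ r′ → r ≡ r′
  path-injective {r = r} {r′} σ∈ same with ℕₚ.<-cmp r r′
  ... | tri< r<r′ _ _ = ⊥-elim (proj₂ (path-⊏ σ∈ r<r′) same)
  ... | tri≈ _ r≡r′ _ = r≡r′
  ... | tri> _ _ r′<r = ⊥-elim (proj₂ (path-⊏ σ∈ r′<r) (sym same))

  snapshot-tuple-meets : ∀ {r} (σ σ′ : Fin k → List A) → Injective _≡_ _≡_ σ → (∀ l → σ l ∈ terminals) →
    (∀ l → T (σ′ l)) → σ ≤ᵏ σ′ → (∀ l → AboveSnapshot r (σ′ l)) → D σ′
  snapshot-tuple-meets {r} σ σ′ σ-injective σ∈ σ′∈T σ≤σ′ above =
    D-open y σ′ (Round.refine-meets (stage r) y y∈ y-injective) σ′∈T y≤σ′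
    where
    y : Fin k → List A
    y l = proj₁ (above l)
    y∈ : ∀ l → y l ∈ snapshot r
    y∈ l = proj₁ (proj₂ (above l))
    y≤σ′ : y ≤ᵏ σ′
    y≤σ′ l = proj₂ (proj₂ (above l))
    σ⊑y : ∀ l → σ l ⊑ y l
    σ⊑y l with snapshot-owned {r} (y∈ l)
    ... | τ , τ∈ , τ⊑y with terminal-unique τ∈ (σ∈ l) (⊑-trans τ⊑y (y≤σ′ l)) (σ≤σ′ l)
    ...   | refl = τ⊑y
    y-injective : Injective _≡_ _≡_ y
    y-injective {a} {b} ya≡yb =
      σ-injective (terminal-unique (σ∈ a) (σ∈ b) (σ⊑y a) (subst (σ b ⊑_) (sym ya≡yb) (σ⊑y b)))

  rounds : ℕ
  rounds = suc k

  tip : List A → List A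
  tip σ = path σ rounds

  W : List (List A)
  W = map tip terminals ++ sides rounds

  T1 : List (List A)
  T1 = T0 ++ concatMap inits W

  tip∈W : ∀ {σ} → σ ∈ terminals → tip σ ∈ W
  tip∈W σ∈ = ∈-++⁺ˡ (∈-map⁺ tip σ∈)

  side∈W : ∀ {w} → w ∈ sides rounds → w ∈ W
  side∈W = ∈-++⁺ʳ (map tip terminals)

  W-cases : ∀ {w} → w ∈ W → (∃[ σ ] (σ ∈ terminals × w ≡ tip σ)) ⊎ SideNode rounds w
  W-cases w∈ with ∈-++⁻ (map tip terminals) w∈
  ... | inj₁ w∈tips = inj₁ (∈-map⁻ tip w∈tips)
  ... | inj₂ w∈sides = inj₂ (sides-are-side-nodes rounds w∈sides)

  W⊆T : ∀ {w} → w ∈ W → T w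
  W⊆T w∈ with ∈-++⁻ (map tip terminals) w∈
  ... | inj₁ w∈tips with ∈-map⁻ tip w∈tips
  ...   | σ , σ∈ , refl = Stage.tip∈T (stage rounds) σ∈
  W⊆T w∈ | inj₂ w∈sides = Stage.sides⊆T (stage rounds) w∈sides

  W-owned : ∀ {w} → w ∈ W → ∃[ σ ] (σ ∈ terminals × σ ⊑ w)
  W-owned w∈ with W-cases w∈
  ... | inj₁ (σ , σ∈ , refl) = σ , σ∈ , terminal⊑path rounds σ∈
  ... | inj₂ node = owner , owner∈terminals , owner⊑
    where open SideNode node

  tip-maximal : ∀ {σ w} → σ ∈ terminals → w ∈ W → tip σ ⊑ w → tip σ ≡ w
  tip-maximal {σ} σ∈ w∈ tip⊑w with W-cases w∈
  ... | inj₁ (τ , τ∈ , refl)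
    with terminal-unique σ∈ τ∈ (⊑-trans (terminal⊑path rounds σ∈) tip⊑w) (terminal⊑path rounds τ∈)
  ...   | refl = refl
  tip-maximal {σ} σ∈ w∈ tip⊑w | inj₂ node
    with terminal-unique σ∈ (SideNode.owner∈terminals node)
                         (⊑-trans (terminal⊑path rounds σ∈) tip⊑w) (SideNode.owner⊑ node)
  ...   | refl = ⊥-elim (SideNode.off-path node (inj₂ tip⊑w))

  W-above-snapshots : ∀ {w} → w ∈ W → ∃[ b ] (∀ {r} → r < rounds → r ≢ b → AboveSnapshot r w)
  W-above-snapshots w∈ with W-cases w∈
  ... | inj₁ (σ , σ∈ , refl) = rounds , λ r<rounds _ → path-above-snapshots σ∈ r<rounds
  ... | inj₂ node = SideNode.birth node , SideNode.above-snapshots node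

  T1-cases : ∀ {t} → t ∈ T1 → t ∈ T0 ⊎ ∃[ w ] (w ∈ W × t ⊑ w)
  T1-cases t∈ with ∈-++⁻ T0 t∈
  ... | inj₁ t∈T0 = inj₁ t∈T0
  ... | inj₂ t∈inits with find (∈-concatMap⁻ inits {xs = W} t∈inits)
  ...   | w , w∈ , t∈inits-w = inj₂ (w , w∈ , ∈-inits⁻ t∈inits-w)

  below-W : ∀ {t w} → w ∈ W → t ⊑ w → t ∈ T1
  below-W w∈ t⊑w = ∈-++⁺ʳ T0 (∈-concatMap⁺ inits (lose w∈ (∈-inits⁺ t⊑w)))

  T1-finite-subtree : IsFiniteSubtree T T1
  T1-finite-subtree = ((t₀ , ∈-++⁺ˡ t₀∈T0) , closed) , T1⊆T
    where
    t₀ : List A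
    t₀ = proj₁ (proj₁ (proj₁ T0-finite))
    t₀∈T0 : t₀ ∈ T0
    t₀∈T0 = proj₂ (proj₁ (proj₁ T0-finite))
    closed : ∀ s t → s ⊑ t → t ∈ T1 → s ∈ T1
    closed s t s⊑t t∈ with T1-cases t∈
    ... | inj₁ t∈T0 = ∈-++⁺ˡ (proj₂ (proj₁ T0-finite) s t s⊑t t∈T0)
    ... | inj₂ (w , w∈ , t⊑w) = below-W w∈ (⊑-trans s⊑t t⊑w)
    T1⊆T : ∀ t → t ∈ T1 → T t
    T1⊆T t t∈ with T1-cases t∈
    ... | inj₁ t∈T0 = T0⊆T t∈T0
    ... | inj₂ (w , w∈ , t⊑w) = proj₂ (proj₁ perfect) t w t⊑w (W⊆T w∈)

  terminal⊏tip : ∀ {σ} → σ ∈ terminals → σ ⊏ tip σ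
  terminal⊏tip σ∈ = path-⊏ {r = 0} {rounds} σ∈ (s≤s z≤n)

  tip-terminal : ∀ {σ} → σ ∈ terminals → term T1 (tip σ)
  tip-terminal {σ} σ∈ = below-W (tip∈W σ∈) (⊑-refl (tip σ)) , maximal
    where
    maximal : ∀ u → u ∈ T1 → ¬ (tip σ ⊏ u)
    maximal u u∈ tip⊏u with T1-cases u∈
    ... | inj₁ u∈T0 = proj₂ (∈-terminals⁻ σ∈) u u∈T0 (⊑-⊏-trans (terminal⊑path rounds σ∈) tip⊏u)
    ... | inj₂ (w , w∈ , u⊑w) =
      let tip⊏w = ⊏-⊑-trans tip⊏u u⊑w in proj₂ tip⊏w (tip-maximal σ∈ w∈ (proj₁ tip⊏w))

  terminal-in-W : ∀ {σ t} → σ ∈ terminals → σ ⊑ t → term T1 t → t ∈ W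
  terminal-in-W {σ} {t} σ∈ σ⊑t t-term with T1-cases (proj₁ t-term)
  ... | inj₁ t∈T0 with term-maximal _≟_ (∈-terminals⁻ σ∈) t∈T0 σ⊑t
  ...   | refl = ⊥-elim (proj₂ t-term (tip σ) (below-W (tip∈W σ∈) (⊑-refl (tip σ))) (terminal⊏tip σ∈))
  terminal-in-W σ∈ σ⊑t t-term | inj₂ (w , w∈ , t⊑w) =
    subst (_∈ W) (sym (term-maximal _≟_ t-term (below-W w∈ (⊑-refl w)) t⊑w)) w∈

  branch : ∀ {σ} → σ ∈ terminals →
    ∃[ m ] ∃[ s ] (Injective {A = Fin (suc (suc m))} _≡_ _≡_ s
      × (∀ i → Cone ⟦ T1 ⟧ σ (s i))
      × s zero ≡ σ
      × term T1 (s (fromℕ (suc m)))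
      × (∀ (i : Fin (suc m)) → ⟦ ρ (s (inject₁ i)) (s (suc i)) ⟧ ⊆ˢ ⟦ T1 ⟧))
  branch {σ} σ∈ =
    k , s , toℕ-injective ∘ path-injective σ∈ , in-cone , refl , last-terminal , weights-in-T1
    where
    s : Fin (suc rounds) → List A
    s i = path σ (toℕ i)
    in-cone : ∀ i → Cone ⟦ T1 ⟧ σ (s i)
    in-cone i = below-W (tip∈W σ∈) (path-⊑ σ∈ (s≤s⁻¹ (toℕ<n i))) , inj₂ (terminal⊑path (toℕ i) σ∈)
    last-terminal : term T1 (s (fromℕ rounds))
    last-terminal = subst (term T1 ∘ path σ) (sym (toℕ-fromℕ rounds)) (tip-terminal σ∈)
    weights-in-T1 : ∀ (i : Fin rounds) → ⟦ ρ (s (inject₁ i)) (s (suc i)) ⟧ ⊆ˢ ⟦ T1 ⟧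
    weights-in-T1 i u u∈ρ
      with weights-covered σ∈ (toℕ<n i) (subst (λ r → u ∈ ρ (path σ r) (s (suc i))) (toℕ-inject₁ i) u∈ρ)
    ... | w , w∈ , u⊑w = below-W (side∈W w∈) u⊑w

  T0◁T1 : ◁ ρ T0 T1
  T0◁T1 = (λ _ → ∈-++⁺ˡ) , new-node , above-terminal , λ _ → branch ∘ ∈-terminals⁺
    where
    new-node : ∃[ t ] (t ∈ T1 × ¬ (t ∈ T0))
    new-node with terminal-exists (proj₂ (proj₁ (proj₁ T0-finite)))
    ... | σ , σ-term = tip σ , below-W (tip∈W σ∈) (⊑-refl (tip σ)) ,
                         λ tip∈T0 → proj₂ σ-term (tip σ) tip∈T0 (terminal⊏tip σ∈)
      where
      σ∈ : σ ∈ terminals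
      σ∈ = ∈-terminals⁺ σ-term
    above-terminal : ∀ t → t ∈ T1 → ¬ (t ∈ T0) → ∃[ σ ] (term T0 σ × σ ⊑ t)
    above-terminal t t∈ t∉T0 with T1-cases t∈
    ... | inj₁ t∈T0 = ⊥-elim (t∉T0 t∈T0)
    ... | inj₂ (w , w∈ , t⊑w) with W-owned w∈
    ...   | σ , σ∈ , σ⊑w with prefixes-comparable t⊑w σ⊑w
    ...     | inj₁ t⊑σ = ⊥-elim (t∉T0 (proj₂ (proj₁ T0-finite) t σ t⊑σ (proj₁ (∈-terminals⁻ σ∈))))
    ...     | inj₂ σ⊑t = σ , ∈-terminals⁻ σ∈ , σ⊑t

  T1-meets-D : ∀ (σ σ′ : Fin k → List A) → Injective _≡_ _≡_ σ →
    (∀ l → term T0 (σ l)) → (∀ l → term T1 (σ′ l)) → σ ≤ᵏ σ′ → D σ′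
  T1-meets-D σ σ′ σ-injective σ-term σ′-term σ≤σ′ =
    snapshot-tuple-meets {toℕ common-round} σ σ′ σ-injective (∈-terminals⁺ ∘ σ-term) σ′∈T σ≤σ′
      (λ l → proj₂ (W-above-snapshots (σ′∈W l)) (toℕ<n common-round) (common-round-avoids l))
    where
    σ′∈W : ∀ l → σ′ l ∈ W
    σ′∈W l = terminal-in-W (∈-terminals⁺ (σ-term l)) (σ≤σ′ l) (σ′-term l)
    σ′∈T : ∀ l → T (σ′ l)
    σ′∈T l = proj₂ T1-finite-subtree (σ′ l) (proj₁ (σ′-term l))
    common-round : Fin rounds
    common-round = proj₁ (avoid-values (proj₁ ∘ W-above-snapshots ∘ σ′∈W))
    common-round-avoids : ∀ l → toℕ common-round ≢ proj₁ (W-above-snapshots (σ′∈W l))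
    common-round-avoids = proj₂ (avoid-values (proj₁ ∘ W-above-snapshots ∘ σ′∈W))

lemma4p15 : (A : Set) → Countable A →
    (T : SeqSet A) → IsPerfectTree T →
    (ρ : List A → List A → List (List A)) → IsWeight T ρ →
    (T0 : List (List A)) → IsFiniteSubtree T T0 →
    (k : ℕ) → (D : (Fin k → List A) → Set) → IsDenseOpen T k D →
    ∃[ T1 ] (IsFiniteSubtree T T1 × ◁ ρ T0 T1 ×
      (∀ (σ σ' : Fin k → List A) → Injective _≡_ _≡_ σ →
        (∀ l → term T0 (σ l)) → (∀ l → term T1 (σ' l)) →
        σ ≤ᵏ σ' → D σ'))
lemma4p15 A countable T perfect ρ weight T0 T0-finite k D dense-open =
  T1 , T1-finite-subtree , T0◁T1 , T1-meets-D
  where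
  open Construction (countable⇒decidableEquality countable) T perfect ρ weight T0 T0-finite k D dense-open
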